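{- For integers $j\ge1$, $m\ge1$ and $p\in\{0,1,\ldots,m\}$, \[ \left\langle {m(j-1)+p \atop m(j-1)}\right\rangle_m=\left\langle {mj \atop mj-p}\right\rangle_m=j^p. \]
   Context: An $N$-board is a linear array of $N$ unit cells. A square is a $1\times1$ tile; a $(1,m-1)$-fence is a tile consisting of two unit square posts separated by a gap of width $m-1$, whose gap may be occupied by other tiles (including posts of other fences). $\left\langle {n \atop k}\right\rangle_m$ denotes the number of tilings of an $(n+k)$-board using exactly $k$ $(1,m-1)$-fences and $n-k$ squares. -}

module Defs where

open import Data.Nat using (ℕ; zero; suc; _+_; _*_; _∸_; _≡ᵇ_; _<ᵇ_)
open import Data.Bool using (Bool; true; false; _∧_; not; if_then_else_)
open import Data.List using (List; []; _∷_; length; filter; map; concatMap; upTo; allFin)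
open import Data.Maybe using (Maybe; just; nothing)
open import Relation.Nullary.Decidable using (Dec)
open import Data.Bool using (T?)

-- A tiling of an N-board is encoded by labelling every cell with the role
-- it plays: a square, the left post of a fence, or the right post of a fence.
-- (The set of tiles is recovered uniquely from such a labelling.)
data Cell : Set where
  sq lpost rpost : Cell

labellings : ℕ → List (List Cell)
labellings zero = [] ∷ []
labellings (suc N) = concatMap (λ t → (sq ∷ t) ∷ (lpost ∷ t) ∷ (rpost ∷ t) ∷ []) (labellings N)

at : List Cell → ℕ → Maybe Cell
at [] _ = nothing
at (c ∷ t) zero = just c
at (c ∷ t) (suc i) = at t i

isL isR isS : Maybe Cell → Bool
isL (just lpost) = true
isL _ = false
isR (just rpost) = true
isR _ = false
isS (just sq) = true
isS _ = false

_⇒ᵇ_ : Bool → Bool → Bool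
a ⇒ᵇ b = not a Data.Bool.∨ b

allBelow : ℕ → (ℕ → Bool) → Bool
allBelow zero f = true
allBelow (suc N) f = allBelow N f ∧ f N

-- validity for (1,m-1)-fences: cell i is a left post iff cell i+m is a right
-- post (the two posts of a fence are at distance m)
validFor : ℕ → List Cell → Bool
validFor m t = allBelow (length t) λ i →
  (isL (at t i) ⇒ᵇ isR (at t (i + m))) ∧
  (isR (at t i) ⇒ᵇ ((m ∸ 1 <ᵇ i) ∧ isL (at t (i ∸ m))))

countCells : (Maybe Cell → Bool) → List Cell → ℕ
countCells p t = length (filter (λ i → T? (p (at t i))) (upTo (length t)))

-- ⟨ n , k ⟩_m : number of tilings of an (n+k)-board with exactly k
-- (1,m-1)-fences and n-k squares
fenceNum : ℕ → ℕ → ℕ → ℕ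
fenceNum m n k = length (filter (λ t → T? (validFor m t ∧ (countCells isL t ≡ᵇ k) ∧ (countCells isS t ≡ᵇ (n ∸ k)))) (labellings (n + k)))

{-# OPTIONS --safe #-}
module Submission where

-- Cell i and cell i + m carry the two posts of a (1,m-1)-fence, so on each residue class of
-- cells modulo m (a thread) the fences are dominoes, and a tiling of the board is the same as
-- an independent square/domino tiling of each of its m threads. A thread of length ℓ needs at
-- least ℓ mod 2 squares, and reaches this bound in exactly one way if ℓ is even and in
-- (ℓ + 1)/2 ways if ℓ is odd. On both boards of the theorem exactly p threads are odd, of
-- length 2j - 1, while the number of squares is p; so every thread uses its minimum, giving j^p.
-- Mechanically, the board is read cell by cell by an automaton whose queue records, thread by
-- thread, whether the next cell must close a fence, and the induction along the reading tracks
-- only the lowest-order coefficient of the generating series in the number of squares.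

open import Defs
open import Data.Nat using (ℕ; zero; suc; _+_; _*_; _∸_; _^_; _≤_; _<_; _≡ᵇ_; _<ᵇ_; z≤n; s≤s; z<s; s<s)
open import Data.Nat.Properties
open import Data.Nat.ListAction using (sum; product)
open import Data.Nat.ListAction.Properties using (sum-++; product-++)
open import Data.Nat.Tactic.RingSolver using (solve-∀)
open import Data.Bool using (Bool; true; false; _∧_; not; T)
open import Data.Bool.ListAction using (all)
open import Data.Bool.Properties using (T-∧; T-≡; ∧-zeroʳ; ∧-identityʳ)
open import Data.List using (List; []; _∷_; [_]; _++_; length; map; filter; replicate; applyUpTo; upTo; concatMap)
open import Data.List.Properties using (length-++; length-map; length-replicate; map-++; map-applyUpTo; map-replicate; map-∘; map-id; ++-assoc; ++-identityʳ; ∷-injectiveˡ; ∷-injectiveʳ)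
open import Data.List.Membership.Propositional using (_∈_)
open import Data.List.Membership.Propositional.Properties using (∈-map⁺)
open import Data.List.Relation.Unary.Any using (here; there)
open import Data.List.Relation.Unary.Any.Properties using (++⁺ˡ; ++⁺ʳ)
open import Data.Maybe using (Maybe; just; nothing)
open import Data.Product using (_×_; _,_; proj₁; proj₂; ∃-syntax)
open import Data.Sum using (_⊎_; inj₁; inj₂)
open import Data.Empty using (⊥-elim)
open import Function using (_∘_; id; Equivalence)
open import Relation.Nullary using (¬_; yes; no)
open import Relation.Nullary.Decidable using (T?)
open import Relation.Binary.PropositionalEquality hiding ([_])

open Equivalence using (to; from)

bit : Bool → ℕ
bit true = 1
bit false = 0

count : {A : Set} → (A → Bool) → List A → ℕ
count p [] = 0
count p (x ∷ xs) = bit (p x) + count p xs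

module _ {A : Set} where

  length-filter≡count : (p : A → Bool) (xs : List A) → length (filter (T? ∘ p) xs) ≡ count p xs
  length-filter≡count p [] = refl
  length-filter≡count p (x ∷ xs) with p x
  ... | true = cong suc (length-filter≡count p xs)
  ... | false = length-filter≡count p xs

  count-map : {B : Set} (p : B → Bool) (f : A → B) (xs : List A) → count p (map f xs) ≡ count (p ∘ f) xs
  count-map p f [] = refl
  count-map p f (x ∷ xs) = cong (bit (p (f x)) +_) (count-map p f xs)

  count-cong : {p q : A → Bool} → p ≗ q → (xs : List A) → count p xs ≡ count q xs
  count-cong p≗q [] = refl
  count-cong p≗q (x ∷ xs) = cong₂ _+_ (cong bit (p≗q x)) (count-cong p≗q xs)

  count-false : (xs : List A) → count (λ _ → false) xs ≡ 0
  count-false [] = refl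
  count-false (x ∷ xs) = count-false xs

  count-++ : (p : A → Bool) (xs ys : List A) → count p (xs ++ ys) ≡ count p xs + count p ys
  count-++ p [] ys = refl
  count-++ p (x ∷ xs) ys = trans (cong (bit (p x) +_) (count-++ p xs ys)) (sym (+-assoc (bit (p x)) _ _))

count-replicate-false : (n : ℕ) → count id (replicate n false) ≡ 0
count-replicate-false zero = refl
count-replicate-false (suc n) = count-replicate-false n

-- Functions ℕ → ℕ are coefficient sequences of power series; shift multiplies by the variable.
shift : (ℕ → ℕ) → ℕ → ℕ
shift f zero = 0
shift f (suc s) = f s

_⊕_ : (ℕ → ℕ) → (ℕ → ℕ) → ℕ → ℕ
(f ⊕ g) s = f s + g s

Vanishes : (ℕ → ℕ) → Set
Vanishes f = ∀ s → f s ≡ 0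

record LowestTerm (f : ℕ → ℕ) (d c : ℕ) : Set where
  field
    below  : ∀ {s} → s < d → f s ≡ 0
    lowest : f d ≡ c
open LowestTerm

LowestTerm-resp : ∀ {f g} → f ≗ g → ∀ {d c} → LowestTerm g d c → LowestTerm f d c
LowestTerm-resp f≗g term = record
  { below = λ s<d → trans (f≗g _) (below term s<d) ; lowest = trans (f≗g _) (lowest term) }

⊕-vanishes : ∀ {f g} → Vanishes f → Vanishes g → Vanishes (f ⊕ g)
⊕-vanishes f≡0 g≡0 s = cong₂ _+_ (f≡0 s) (g≡0 s)

⊕-lowest : ∀ {f g d c c'} → LowestTerm f d c → LowestTerm g d c' → LowestTerm (f ⊕ g) d (c + c')
⊕-lowest f-term g-term = record
  { below = λ s<d → cong₂ _+_ (below f-term s<d) (below g-term s<d)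
  ; lowest = cong₂ _+_ (lowest f-term) (lowest g-term) }

⊕-lowestˡ : ∀ {f g d d' c c'} → LowestTerm f d c → LowestTerm g d' c' → d < d' → LowestTerm (f ⊕ g) d c
⊕-lowestˡ f-term g-term d<d' = record
  { below = λ s<d → cong₂ _+_ (below f-term s<d) (below g-term (<-trans s<d d<d'))
  ; lowest = trans (cong₂ _+_ (lowest f-term) (below g-term d<d')) (+-identityʳ _) }

⊕-lowestʳ : ∀ {f g d d' c c'} → LowestTerm f d c → LowestTerm g d' c' → d' < d → LowestTerm (f ⊕ g) d' c'
⊕-lowestʳ {f} {g} f-term g-term d'<d = LowestTerm-resp (λ s → +-comm (f s) (g s)) (⊕-lowestˡ g-term f-term d'<d)

vanishes⇒lowestTerm : ∀ {f} → Vanishes f → ∀ {d} → LowestTerm f d 0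
vanishes⇒lowestTerm f≡0 = record { below = λ _ → f≡0 _ ; lowest = f≡0 _ }

shift-vanishes : ∀ {f} → Vanishes f → Vanishes (shift f)
shift-vanishes f≡0 zero = refl
shift-vanishes f≡0 (suc s) = f≡0 s

shift-lowest : ∀ {f d c} → LowestTerm f d c → LowestTerm (shift f) (suc d) c
shift-lowest {f} {d} term = record { below = shift-below ; lowest = lowest term }
  where
  shift-below : ∀ {s} → s < suc d → shift f s ≡ 0
  shift-below {zero} _ = refl
  shift-below {suc s} (s<s s<d) = below term s<d

applyUpTo-at : (t : List Cell) → applyUpTo (at t) (length t) ≡ map just t
applyUpTo-at [] = refl
applyUpTo-at (c ∷ t) = cong (just c ∷_) (applyUpTo-at t)

countCells≡count : (p : Maybe Cell → Bool) (t : List Cell) → countCells p t ≡ count (p ∘ just) t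
countCells≡count p t = begin
  countCells p t                          ≡⟨ length-filter≡count (p ∘ at t) (upTo (length t)) ⟩
  count (p ∘ at t) (upTo (length t))      ≡⟨ count-map p (at t) (upTo (length t)) ⟨
  count p (map (at t) (upTo (length t)))  ≡⟨ cong (count p) (map-applyUpTo id (at t) (length t)) ⟩
  count p (applyUpTo (at t) (length t))   ≡⟨ cong (count p) (applyUpTo-at t) ⟩
  count p (map just t)                    ≡⟨ count-map p just t ⟩
  count (p ∘ just) t                      ∎
  where open ≡-Reasoning

count-labellings-suc : (f : List Cell → Bool) (N : ℕ) →
  count f (labellings (suc N)) ≡
  count (f ∘ (sq ∷_)) (labellings N) + count (f ∘ (lpost ∷_)) (labellings N) + count (f ∘ (rpost ∷_)) (labellings N)
count-labellings-suc f N = count-extend (labellings N)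
  where
  regroup : ∀ a b c x y z → a + (b + (c + (x + y + z))) ≡ a + x + (b + y) + (c + z)
  regroup = solve-∀
  count-extend : (ts : List (List Cell)) →
    count f (concatMap (λ t → (sq ∷ t) ∷ (lpost ∷ t) ∷ (rpost ∷ t) ∷ []) ts) ≡
    count (f ∘ (sq ∷_)) ts + count (f ∘ (lpost ∷_)) ts + count (f ∘ (rpost ∷_)) ts
  count-extend [] = refl
  count-extend (t ∷ ts) = trans (cong (λ r → bit (f (sq ∷ t)) + (bit (f (lpost ∷ t)) + (bit (f (rpost ∷ t)) + r))) (count-extend ts))
                      (regroup (bit (f (sq ∷ t))) (bit (f (lpost ∷ t))) (bit (f (rpost ∷ t)))
                               (count (f ∘ (sq ∷_)) ts) (count (f ∘ (lpost ∷_)) ts) (count (f ∘ (rpost ∷_)) ts))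

count-labellings-cong : (N : ℕ) {f g : List Cell → Bool} → (∀ t → length t ≡ N → f t ≡ g t) →
  count f (labellings N) ≡ count g (labellings N)
count-labellings-cong zero f≐g = cong (λ b → bit b + 0) (f≐g [] refl)
count-labellings-cong (suc N) {f} {g} f≐g = begin
  count f (labellings (suc N))  ≡⟨ count-labellings-suc f N ⟩
  _                             ≡⟨ cong₂ _+_ (cong₂ _+_ (extend sq) (extend lpost)) (extend rpost) ⟩
  _                             ≡⟨ count-labellings-suc g N ⟨
  count g (labellings (suc N))  ∎
  where
  open ≡-Reasoning
  extend : ∀ c → count (f ∘ (c ∷_)) (labellings N) ≡ count (g ∘ (c ∷_)) (labellings N)
  extend c = count-labellings-cong N (λ t e → f≐g (c ∷ t) (cong suc e))

isSquare isLeftPost isRightPost : Cell → Bool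
isSquare c = isS (just c)
isLeftPost c = isL (just c)
isRightPost c = isR (just c)

squares : List Cell → ℕ
squares = count isSquare

rightPosts leftPosts : List Cell → List Bool
rightPosts = map isRightPost
leftPosts = map isLeftPost

length≡squares+posts : (t : List Cell) → length t ≡ squares t + (count isLeftPost t + count isRightPost t)
length≡squares+posts [] = refl
length≡squares+posts (sq ∷ t) = cong suc (length≡squares+posts t)
length≡squares+posts (lpost ∷ t) = trans (cong suc (length≡squares+posts t)) (sym (+-suc (squares t) _))
length≡squares+posts (rpost ∷ t) = begin
  suc (length t)                                              ≡⟨ cong suc (length≡squares+posts t) ⟩
  suc (squares t + (count isLeftPost t + count isRightPost t)) ≡⟨ +-suc (squares t) _ ⟨
  squares t + suc (count isLeftPost t + count isRightPost t)   ≡⟨ cong (squares t +_) (+-suc (count isLeftPost t) _) ⟨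
  squares t + (count isLeftPost t + suc (count isRightPost t)) ∎
  where open ≡-Reasoning

_!_ : List Bool → ℕ → Bool
[] ! i = false
(b ∷ bs) ! zero = b
(b ∷ bs) ! suc i = bs ! i

!-ext : (xs ys : List Bool) → length xs ≡ length ys → (∀ i → xs ! i ≡ ys ! i) → xs ≡ ys
!-ext [] [] _ _ = refl
!-ext (x ∷ xs) (y ∷ ys) eq pointwise = cong₂ _∷_ (pointwise 0) (!-ext xs ys (suc-injective eq) (pointwise ∘ suc))

!-replicate : (m i : ℕ) → replicate m false ! i ≡ false
!-replicate zero i = refl
!-replicate (suc m) zero = refl
!-replicate (suc m) (suc i) = !-replicate m i

!-padded : (t : List Cell) (m i : ℕ) → (rightPosts t ++ replicate m false) ! i ≡ isR (at t i)
!-padded [] m i = !-replicate m i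
!-padded (c ∷ t) m zero = refl
!-padded (c ∷ t) m (suc i) = !-padded t m i

!-leftPosts : (t : List Cell) (i : ℕ) → leftPosts t ! i ≡ isL (at t i)
!-leftPosts [] i = refl
!-leftPosts (c ∷ t) zero = refl
!-leftPosts (c ∷ t) (suc i) = !-leftPosts t i

!-delay-< : ∀ {m i} (bs : List Bool) → i < m → (replicate m false ++ bs) ! i ≡ false
!-delay-< {suc m} {zero} bs _ = refl
!-delay-< {suc m} {suc i} bs (s<s i<m) = !-delay-< bs i<m

!-delay-+ : (m : ℕ) (bs : List Bool) (i : ℕ) → (replicate m false ++ bs) ! (m + i) ≡ bs ! i
!-delay-+ zero bs i = refl
!-delay-+ (suc m) bs i = !-delay-+ m bs i

<⊎≡+ : (m i : ℕ) → i < m ⊎ ∃[ i' ] i ≡ m + i'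
<⊎≡+ m i with i <? m
... | yes i<m = inj₁ i<m
... | no i≮m = inj₂ (i ∸ m , sym (m+[n∸m]≡n (≮⇒≥ i≮m)))

T-ext : ∀ {a b} → (T a → T b) → (T b → T a) → a ≡ b
T-ext {false} {false} _ _ = refl
T-ext {false} {true} _ b⇒a = ⊥-elim (b⇒a _)
T-ext {true} a⇒b _ = sym (to T-≡ (a⇒b _))

⇒ᵇ-elim : ∀ {a b} → T (a ⇒ᵇ b) → T a → T b
⇒ᵇ-elim {true} h _ = h

⇒ᵇ-intro : ∀ a {b} → (T a → T b) → T (a ⇒ᵇ b)
⇒ᵇ-intro false _ = _
⇒ᵇ-intro true f = f _

allBelow-sound : ∀ N f → T (allBelow N f) → ∀ {i} → i < N → T (f i)
allBelow-sound (suc N) f h {i} i<1+N with m<1+n⇒m<n∨m≡n i<1+N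
... | inj₁ i<N = allBelow-sound N f (proj₁ (to T-∧ h)) i<N
... | inj₂ refl = proj₂ (to T-∧ h)

allBelow-complete : ∀ N f → (∀ {i} → i < N → T (f i)) → T (allBelow N f)
allBelow-complete zero f _ = _
allBelow-complete (suc N) f h = from T-∧ (allBelow-complete N f (h ∘ m<n⇒m<1+n) , h (n<1+n N))

at-in-range : (p : Maybe Cell → Bool) → ¬ T (p nothing) → ∀ t i → T (p (at t i)) → i < length t
at-in-range p ¬p[nothing] [] i h = ⊥-elim (¬p[nothing] h)
at-in-range p ¬p[nothing] (c ∷ t) zero h = z<s
at-in-range p ¬p[nothing] (c ∷ t) (suc i) h = s<s (at-in-range p ¬p[nothing] t i h)

module _ (m : ℕ) (t : List Cell) where

  delayedLeftPosts : List Bool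
  delayedLeftPosts = replicate (suc m) false ++ leftPosts t

  delayedLeftPosts-at : ∀ i → delayedLeftPosts ! (suc m + i) ≡ isL (at t i)
  delayedLeftPosts-at i = trans (!-delay-+ (suc m) (leftPosts t) i) (!-leftPosts t i)

  module _ (valid : T (validFor (suc m) t)) where

    private
      postsOk : ∀ {i} → i < length t →
        T ((isL (at t i) ⇒ᵇ isR (at t (i + suc m))) ∧ (isR (at t i) ⇒ᵇ ((m <ᵇ i) ∧ isL (at t (i ∸ suc m)))))
      postsOk = allBelow-sound (length t) _ valid

    leftPost⇒rightPost : ∀ i → T (isL (at t i)) → T (isR (at t (suc m + i)))
    leftPost⇒rightPost i left =
      subst (T ∘ isR ∘ at t) (+-comm i (suc m))
        (⇒ᵇ-elim (proj₁ (to T-∧ (postsOk (at-in-range isL (λ ()) t i left)))) left)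

    rightPost⇒leftPost : ∀ i → T (isR (at t i)) → suc m ≤ i × T (isL (at t (i ∸ suc m)))
    rightPost⇒leftPost i right =
      let m<i , left = to T-∧ (⇒ᵇ-elim (proj₂ (to T-∧ (postsOk (at-in-range isR (λ ()) t i right)))) right)
      in <ᵇ⇒< m i m<i , left

    valid⇒delayed : ∀ i → isR (at t i) ≡ delayedLeftPosts ! i
    valid⇒delayed i with <⊎≡+ (suc m) i
    ... | inj₁ i<1+m = trans (T-ext (λ right → ⊥-elim (<⇒≱ i<1+m (proj₁ (rightPost⇒leftPost i right)))) λ ())
                             (sym (!-delay-< (leftPosts t) i<1+m))
    ... | inj₂ (i' , refl) = trans (T-ext right⇒left (leftPost⇒rightPost i')) (sym (delayedLeftPosts-at i'))
      where
      right⇒left : T (isR (at t (suc m + i'))) → T (isL (at t i'))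
      right⇒left right = subst (T ∘ isL ∘ at t) (m+n∸m≡n (suc m) i') (proj₂ (rightPost⇒leftPost _ right))

  delayed⇒valid : (∀ i → isR (at t i) ≡ delayedLeftPosts ! i) → T (validFor (suc m) t)
  delayed⇒valid R≡L = allBelow-complete (length t) _ λ {i} _ → from T-∧ (⇒ᵇ-intro _ (left⇒right i) , ⇒ᵇ-intro _ (right⇒left i))
    where
    left⇒right : ∀ i → T (isL (at t i)) → T (isR (at t (i + suc m)))
    left⇒right i = subst T (sym (trans (R≡L (i + suc m)) (trans (cong (delayedLeftPosts !_) (+-comm i (suc m))) (delayedLeftPosts-at i))))
    right⇒left : ∀ i → T (isR (at t i)) → T ((m <ᵇ i) ∧ isL (at t (i ∸ suc m)))
    right⇒left i right with <⊎≡+ (suc m) i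
    ... | inj₁ i<1+m = ⊥-elim (subst T (trans (R≡L i) (!-delay-< (leftPosts t) i<1+m)) right)
    ... | inj₂ (i' , refl) = from T-∧ (<⇒<ᵇ (s≤s (m≤m+n m i')) ,
            subst (T ∘ isL ∘ at t) (sym (m+n∸m≡n (suc m) i')) (subst T (trans (R≡L _) (delayedLeftPosts-at i')) right))

  valid⇒rightPosts≡delayed : T (validFor (suc m) t) → rightPosts t ++ replicate (suc m) false ≡ delayedLeftPosts
  valid⇒rightPosts≡delayed valid = !-ext _ _ lengths (λ i → trans (!-padded t (suc m) i) (valid⇒delayed valid i))
    where
    lengths : length (rightPosts t ++ replicate (suc m) false) ≡ length delayedLeftPosts
    lengths = begin
      length (rightPosts t ++ replicate (suc m) false)  ≡⟨ length-++ (rightPosts t) ⟩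
      length (rightPosts t) + length (replicate (suc m) false) ≡⟨ cong₂ _+_ (length-map isRightPost t) (length-replicate (suc m)) ⟩
      length t + suc m                                  ≡⟨ +-comm (length t) (suc m) ⟩
      suc m + length t                                  ≡⟨ cong₂ _+_ (length-replicate (suc m)) (length-map isLeftPost t) ⟨
      length (replicate (suc m) false) + length (leftPosts t) ≡⟨ length-++ (replicate (suc m) false) ⟨
      length delayedLeftPosts                           ∎
      where open ≡-Reasoning

  rightPosts≡delayed⇒valid : rightPosts t ++ replicate (suc m) false ≡ delayedLeftPosts → T (validFor (suc m) t)
  rightPosts≡delayed⇒valid eq = delayed⇒valid (λ i → trans (sym (!-padded t (suc m) i)) (cong (_! i) eq))

-- q lists the obligations of the next length q cells: cell i of t is a right post iff
-- entry i of q ++ leftPosts t is true.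
PostsPaired : List Bool → List Cell → Set
PostsPaired q t = rightPosts t ++ replicate (length q) false ≡ q ++ leftPosts t

accepts : List Bool → List Cell → Bool
accepts q [] = all not q
accepts [] (c ∷ t) = isSquare c ∧ accepts [] t
accepts (true ∷ q) (c ∷ t) = isRightPost c ∧ accepts (q ++ [ isLeftPost c ]) t
accepts (false ∷ q) (c ∷ t) = not (isRightPost c) ∧ accepts (q ++ [ isLeftPost c ]) t

length-∷ʳ : ∀ {A : Set} (q : List A) x → length (q ++ [ x ]) ≡ suc (length q)
length-∷ʳ q x = trans (length-++ q) (+-comm (length q) 1)

module _ (q : List Bool) (x : Bool) (t : List Cell) where

  PostsPaired-∷ʳ⁻ : PostsPaired (q ++ [ x ]) t → rightPosts t ++ replicate (suc (length q)) false ≡ q ++ x ∷ leftPosts t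
  PostsPaired-∷ʳ⁻ eq = trans (cong (λ n → rightPosts t ++ replicate n false) (sym (length-∷ʳ q x)))
                         (trans eq (++-assoc q [ x ] (leftPosts t)))

  PostsPaired-∷ʳ⁺ : rightPosts t ++ replicate (suc (length q)) false ≡ q ++ x ∷ leftPosts t → PostsPaired (q ++ [ x ]) t
  PostsPaired-∷ʳ⁺ eq = trans (cong (λ n → rightPosts t ++ replicate n false) (length-∷ʳ q x))
                         (trans eq (sym (++-assoc q [ x ] (leftPosts t))))

all-not⇒replicate : (q : List Bool) → T (all not q) → replicate (length q) false ≡ q
all-not⇒replicate [] _ = refl
all-not⇒replicate (false ∷ q) h = cong (false ∷_) (all-not⇒replicate q h)

replicate⇒all-not : (q : List Bool) → replicate (length q) false ≡ q → T (all not q)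
replicate⇒all-not [] _ = _
replicate⇒all-not (false ∷ q) eq = replicate⇒all-not q (∷-injectiveʳ eq)

accepts⇒PostsPaired : ∀ q t → T (accepts q t) → PostsPaired q t
accepts⇒PostsPaired q [] h = trans (all-not⇒replicate q h) (sym (++-identityʳ q))
accepts⇒PostsPaired [] (sq ∷ t) h = cong (false ∷_) (accepts⇒PostsPaired [] t h)
accepts⇒PostsPaired (true ∷ q) (rpost ∷ t) h = cong (true ∷_) (PostsPaired-∷ʳ⁻ q false t (accepts⇒PostsPaired _ t h))
accepts⇒PostsPaired (false ∷ q) (sq ∷ t) h = cong (false ∷_) (PostsPaired-∷ʳ⁻ q false t (accepts⇒PostsPaired _ t h))
accepts⇒PostsPaired (false ∷ q) (lpost ∷ t) h = cong (false ∷_) (PostsPaired-∷ʳ⁻ q true t (accepts⇒PostsPaired _ t h))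

PostsPaired⇒accepts : ∀ q t → PostsPaired q t → T (accepts q t)
PostsPaired⇒accepts q [] eq = replicate⇒all-not q (trans eq (++-identityʳ q))
PostsPaired⇒accepts [] (sq ∷ t) eq = PostsPaired⇒accepts [] t (∷-injectiveʳ eq)
PostsPaired⇒accepts (true ∷ q) (rpost ∷ t) eq = PostsPaired⇒accepts _ t (PostsPaired-∷ʳ⁺ q false t (∷-injectiveʳ eq))
PostsPaired⇒accepts (false ∷ q) (sq ∷ t) eq = PostsPaired⇒accepts _ t (PostsPaired-∷ʳ⁺ q false t (∷-injectiveʳ eq))
PostsPaired⇒accepts (false ∷ q) (lpost ∷ t) eq = PostsPaired⇒accepts _ t (PostsPaired-∷ʳ⁺ q true t (∷-injectiveʳ eq))

module _ (m : ℕ) (t : List Cell) where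

  private
    PostsPaired-replicate : PostsPaired (replicate (suc m) false) t ≡ (rightPosts t ++ replicate (suc m) false ≡ delayedLeftPosts m t)
    PostsPaired-replicate = cong (λ n → rightPosts t ++ replicate n false ≡ delayedLeftPosts m t) (length-replicate (suc m))

  validFor≡accepts : validFor (suc m) t ≡ accepts (replicate (suc m) false) t
  validFor≡accepts = T-ext
    (λ valid → PostsPaired⇒accepts _ t (subst id (sym PostsPaired-replicate) (valid⇒rightPosts≡delayed m t valid)))
    (λ acc → rightPosts≡delayed⇒valid m t (subst id PostsPaired-replicate (accepts⇒PostsPaired _ t acc)))

  rightPostCount≡leftPostCount : T (validFor (suc m) t) → count isRightPost t ≡ count isLeftPost t
  rightPostCount≡leftPostCount valid = begin
    count isRightPost t                                            ≡⟨ count-map id isRightPost t ⟨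
    count id (rightPosts t)                                        ≡⟨ +-identityʳ _ ⟨
    count id (rightPosts t) + 0                                    ≡⟨ cong (count id (rightPosts t) +_) (count-replicate-false (suc m)) ⟨
    count id (rightPosts t) + count id (replicate (suc m) false)   ≡⟨ count-++ id (rightPosts t) _ ⟨
    count id (rightPosts t ++ replicate (suc m) false)             ≡⟨ cong (count id) (valid⇒rightPosts≡delayed m t valid) ⟩
    count id (delayedLeftPosts m t)                                ≡⟨ count-++ id (replicate (suc m) false) _ ⟩
    count id (replicate (suc m) false) + count id (leftPosts t)    ≡⟨ cong (_+ count id (leftPosts t)) (count-replicate-false (suc m)) ⟩
    count id (leftPosts t)                                         ≡⟨ count-map id isLeftPost t ⟩
    count isLeftPost t                                             ∎
    where open ≡-Reasoning

  fenceCount-determined : ∀ {n k} → T (validFor (suc m) t) → k ≤ n → length t ≡ n + k → squares t ≡ n ∸ k →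
    count isLeftPost t ≡ k
  fenceCount-determined {n} {k} valid k≤n length≡ squares≡ = *-cancelˡ-≡ _ _ 2 (+-cancelˡ-≡ (n ∸ k) _ _ (begin
    n ∸ k + 2 * L                 ≡⟨ cong (λ s → s + (L + (L + 0))) squares≡ ⟨
    squares t + (L + (L + 0))     ≡⟨ cong (λ r → squares t + (L + r))
                                           (trans (+-identityʳ L) (sym (rightPostCount≡leftPostCount valid))) ⟩
    squares t + (L + count isRightPost t) ≡⟨ length≡squares+posts t ⟨
    length t                      ≡⟨ length≡ ⟩
    n + k                         ≡⟨ cong (_+ k) (m∸n+n≡m k≤n) ⟨
    n ∸ k + k + k                 ≡⟨ regroup (n ∸ k) k ⟩
    n ∸ k + 2 * k                 ∎))
    where
    open ≡-Reasoning
    L = count isLeftPost t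
    regroup : ∀ a b → a + b + b ≡ a + 2 * b
    regroup = solve-∀

tilings : List Bool → ℕ → ℕ → ℕ
tilings q n s = count (λ t → accepts q t ∧ (squares t ≡ᵇ s)) (labellings n)

∧-redundant : ∀ a b c → (T a → T c → T b) → a ∧ b ∧ c ≡ a ∧ c
∧-redundant false b c _ = refl
∧-redundant true b false _ = ∧-zeroʳ b
∧-redundant true true true _ = refl
∧-redundant true false true b = ⊥-elim (b _ _)

fenceNum≡tilings : ∀ {m n k} → 1 ≤ m → k ≤ n → fenceNum m n k ≡ tilings (replicate m false) (n + k) (n ∸ k)
fenceNum≡tilings {suc m} {n} {k} _ k≤n = trans (length-filter≡count _ (labellings (n + k)))
  (count-labellings-cong (n + k) λ t length≡ → begin
    validFor (suc m) t ∧ (countCells isL t ≡ᵇ k) ∧ (countCells isS t ≡ᵇ n ∸ k)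
      ≡⟨ cong₂ _∧_ (validFor≡accepts m t)
               (cong₂ (λ b c → (b ≡ᵇ k) ∧ (c ≡ᵇ n ∸ k)) (countCells≡count isL t) (countCells≡count isS t)) ⟩
    accepts (replicate (suc m) false) t ∧ (count isLeftPost t ≡ᵇ k) ∧ (squares t ≡ᵇ n ∸ k)
      ≡⟨ ∧-redundant _ _ _ (λ acc sq≡ → ≡⇒≡ᵇ _ _ (fenceCount-determined m t (subst T (sym (validFor≡accepts m t)) acc) k≤n length≡
                                                   (≡ᵇ⇒≡ _ _ sq≡))) ⟩
    accepts (replicate (suc m) false) t ∧ (squares t ≡ᵇ n ∸ k) ∎)
  where open ≡-Reasoning

tilings-exhausted : ∀ q s → tilings q 0 s ≡ bit (all not q ∧ (0 ≡ᵇ s))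
tilings-exhausted q s = +-identityʳ _

tilings-pending : ∀ q n → tilings (true ∷ q) (suc n) ≗ tilings (q ++ [ false ]) n
tilings-pending q n s = trans (count-labellings-suc _ n)
  (cong₂ (λ a b → a + b + tilings (q ++ [ false ]) n s) (count-false (labellings n)) (count-false (labellings n)))

tilings-free : ∀ q n → tilings (false ∷ q) (suc n) ≗ shift (tilings (q ++ [ false ]) n) ⊕ tilings (q ++ [ true ]) n
tilings-free q n s = trans (count-labellings-suc _ n)
  (trans (cong (λ r → squareFirst s + tilings (q ++ [ true ]) n s + r) (count-false (labellings n)))
         (trans (+-identityʳ _) (cong (_+ tilings (q ++ [ true ]) n s) (squareFirst≡ s))))
  where
  squareFirst : ℕ → ℕ
  squareFirst s = count (λ t → accepts (q ++ [ false ]) t ∧ (suc (squares t) ≡ᵇ s)) (labellings n)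
  squareFirst≡ : ∀ s → squareFirst s ≡ shift (tilings (q ++ [ false ]) n) s
  squareFirst≡ zero = trans (count-cong (λ t → ∧-zeroʳ (accepts (q ++ [ false ]) t)) (labellings n)) (count-false (labellings n))
  squareFirst≡ (suc s) = refl

parity : ℕ → ℕ
parity zero = 0
parity (suc zero) = 1
parity (suc (suc ℓ)) = parity ℓ

-- The number of square/domino tilings of an ℓ-board with the least number, parity ℓ, of squares.
minTilings : ℕ → ℕ
minTilings zero = 1
minTilings (suc zero) = 1
minTilings (suc (suc ℓ)) = minTilings ℓ + parity ℓ

parity-suc : ∀ ℓ → parity ℓ ≡ 0 × parity (suc ℓ) ≡ 1 ⊎ parity ℓ ≡ 1 × parity (suc ℓ) ≡ 0
parity-suc zero = inj₁ (refl , refl)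
parity-suc (suc zero) = inj₂ (refl , refl)
parity-suc (suc (suc ℓ)) = parity-suc ℓ

minTilings-even : ∀ ℓ → parity ℓ ≡ 0 → minTilings ℓ ≡ 1
minTilings-even zero _ = refl
minTilings-even (suc (suc ℓ)) even = cong₂ _+_ (minTilings-even ℓ even) even

-- A thread: whether its next cell must be a right post, and how many of its cells remain.
-- (true , 0) is stuck: no tiling completes it.
Thread : Set
Thread = Bool × ℕ

threadMinSquares threadMinTilings : Thread → ℕ
threadMinSquares (false , ℓ) = parity ℓ
threadMinSquares (true , zero) = 0
threadMinSquares (true , suc ℓ) = parity ℓ
threadMinTilings (false , ℓ) = minTilings ℓ
threadMinTilings (true , zero) = 0
threadMinTilings (true , suc ℓ) = minTilings ℓ

State : Set
State = List Thread

pending : State → List Bool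
pending = map proj₁

lengths : State → List ℕ
lengths = map proj₂

minSquares minCount : State → ℕ
minSquares st = sum (map threadMinSquares st)
minCount st = product (map threadMinTilings st)

record Profile (n : ℕ) (st : State) : Set where
  field
    stuck⇒vanishes : (true , 0) ∈ st → Vanishes (tilings (pending st) n)
    lowestTerm     : LowestTerm (tilings (pending st) n) (minSquares st) (minCount st)
open Profile

true∈⇒all-not-false : ∀ {q} → true ∈ q → all not q ≡ false
true∈⇒all-not-false (here refl) = refl
true∈⇒all-not-false {false ∷ q} (there true∈q) = true∈⇒all-not-false true∈q
true∈⇒all-not-false {true ∷ q} (there _) = refl

exhausted-minima : ∀ st → sum (lengths st) ≡ 0 → minSquares st ≡ 0 × minCount st ≡ bit (all not (pending st))
exhausted-minima [] _ = refl , refl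
exhausted-minima ((b , ℓ) ∷ R) total with m+n≡0⇒m≡0 ℓ total | exhausted-minima R (m+n≡0⇒n≡0 ℓ total)
exhausted-minima ((false , ℓ) ∷ R) total | refl | S≡0 , C≡ = S≡0 , trans (+-identityʳ _) C≡
exhausted-minima ((true , ℓ) ∷ R) total | refl | S≡0 , _ = S≡0 , refl

profile-exhausted : ∀ st → sum (lengths st) ≡ 0 → Profile 0 st
profile-exhausted st total = record
  { stuck⇒vanishes = λ stuck s → cong (λ b → bit (b ∧ (0 ≡ᵇ s)) + 0) (true∈⇒all-not-false (∈-map⁺ proj₁ stuck))
  ; lowestTerm = record
    { below = λ s<S → ⊥-elim (n≮0 (subst (_ <_) S≡0 s<S))
    ; lowest = begin
        tilings (pending st) 0 (minSquares st) ≡⟨ cong (tilings (pending st) 0) S≡0 ⟩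
        tilings (pending st) 0 0               ≡⟨ tilings-exhausted (pending st) 0 ⟩
        bit (all not (pending st) ∧ true)      ≡⟨ cong bit (∧-identityʳ _) ⟩
        bit (all not (pending st))             ≡⟨ C≡ ⟨
        minCount st                            ∎ } }
  where
  open ≡-Reasoning
  S≡0 = proj₁ (exhausted-minima st total)
  C≡ = proj₂ (exhausted-minima st total)

module _ {n : ℕ} (R : State) (y : Thread) (profile : Profile n (R ++ [ y ])) where

  lowestTerm-∷ʳ : LowestTerm (tilings (pending R ++ [ proj₁ y ]) n)
                             (minSquares R + threadMinSquares y) (minCount R * threadMinTilings y)
  lowestTerm-∷ʳ = subst (λ q → LowestTerm (tilings q n) (minSquares R + threadMinSquares y) (minCount R * threadMinTilings y))
                        (map-++ proj₁ R [ y ])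
    (subst₂ (LowestTerm (tilings (pending (R ++ [ y ])) n)) minSquares-∷ʳ minCount-∷ʳ (lowestTerm profile))
    where
    minSquares-∷ʳ : minSquares (R ++ [ y ]) ≡ minSquares R + threadMinSquares y
    minSquares-∷ʳ = trans (cong sum (map-++ threadMinSquares R [ y ]))
                      (trans (sum-++ (map threadMinSquares R) _) (cong (minSquares R +_) (+-identityʳ _)))
    minCount-∷ʳ : minCount (R ++ [ y ]) ≡ minCount R * threadMinTilings y
    minCount-∷ʳ = trans (cong product (map-++ threadMinTilings R [ y ]))
                    (trans (product-++ (map threadMinTilings R) _) (cong (minCount R *_) (*-identityʳ _)))

  vanishes-∷ʳ : (true , 0) ∈ R ⊎ y ≡ (true , 0) → Vanishes (tilings (pending R ++ [ proj₁ y ]) n)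
  vanishes-∷ʳ stuck = subst (λ q → Vanishes (tilings q n)) (map-++ proj₁ R [ y ])
    (stuck⇒vanishes profile (stuck∈ stuck))
    where
    stuck∈ : (true , 0) ∈ R ⊎ y ≡ (true , 0) → (true , 0) ∈ R ++ [ y ]
    stuck∈ (inj₁ stuck∈R) = ++⁺ˡ stuck∈R
    stuck∈ (inj₂ refl) = ++⁺ʳ R (here refl)

profile-pending : ∀ {n} R ℓ → Profile n (R ++ [ (false , ℓ) ]) → Profile (suc n) ((true , suc ℓ) ∷ R)
profile-pending {n} R ℓ profile = record
  { stuck⇒vanishes = λ { (there stuck) s → trans (tilings-pending (pending R) n s) (vanishes-∷ʳ R _ profile (inj₁ stuck) s) }
  ; lowestTerm = LowestTerm-resp (tilings-pending (pending R) n)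
      (subst₂ (LowestTerm _) (+-comm (minSquares R) (parity ℓ)) (*-comm (minCount R) (minTilings ℓ))
        (lowestTerm-∷ʳ R _ profile)) }

module _ {n : ℕ} (R : State) where

  private
    D = minSquares R
    C = minCount R

  -- The next cell is a square (first summand) or opens a fence (second summand); which of the
  -- two realises the minimum depends on the parity of the rest of the thread.
  free-lowestTerm : ∀ ℓ → Profile n (R ++ [ (false , ℓ) ]) → Profile n (R ++ [ (true , ℓ) ]) →
    LowestTerm (shift (tilings (pending R ++ [ false ]) n) ⊕ tilings (pending R ++ [ true ]) n)
               (parity (suc ℓ) + D) (minTilings (suc ℓ) * C)
  free-lowestTerm zero afterSquare afterPost =
    subst₂ (LowestTerm _) (cong suc (+-identityʳ D)) (*-comm C 1)
      (⊕-lowestˡ (shift-lowest (lowestTerm-∷ʳ R _ afterSquare))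
                 (vanishes⇒lowestTerm (vanishes-∷ʳ R _ afterPost (inj₂ refl))) (n<1+n _))
  free-lowestTerm (suc ℓ) afterSquare afterPost with parity-suc ℓ
  ... | inj₁ (even , odd) =
    subst₂ (LowestTerm _) (+-comm D (parity ℓ)) coefficient
      (⊕-lowestʳ (shift-lowest (lowestTerm-∷ʳ R _ afterSquare)) (lowestTerm-∷ʳ R _ afterPost) (s≤s (+-monoʳ-≤ D parities)))
    where
    parities : parity ℓ ≤ parity (suc ℓ)
    parities = subst₂ _≤_ (sym even) (sym odd) z≤n
    coefficient : C * minTilings ℓ ≡ (minTilings ℓ + parity ℓ) * C
    coefficient = trans (*-comm C _) (cong (_* C) (sym (trans (cong (minTilings ℓ +_) even) (+-identityʳ _))))
  ... | inj₂ (odd , even) =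
    subst₂ (LowestTerm _) (cong (_+ D) (sym odd)) coefficient
      (⊕-lowest (subst₂ (LowestTerm _) (cong suc (trans (cong (D +_) even) (+-identityʳ D)))
                                        (trans (cong (C *_) (minTilings-even (suc ℓ) even)) (*-identityʳ C))
                                        (shift-lowest (lowestTerm-∷ʳ R _ afterSquare)))
                (subst₂ (LowestTerm _) (trans (cong (D +_) odd) (+-comm D 1)) refl (lowestTerm-∷ʳ R _ afterPost)))
    where
    coefficient : C + C * minTilings ℓ ≡ (minTilings ℓ + parity ℓ) * C
    coefficient = trans (regroup C (minTilings ℓ)) (cong (λ p → (minTilings ℓ + p) * C) (sym odd))
      where
      regroup : ∀ c w → c + c * w ≡ (w + 1) * c
      regroup = solve-∀

  profile-free : ∀ ℓ → Profile n (R ++ [ (false , ℓ) ]) → Profile n (R ++ [ (true , ℓ) ]) →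
    Profile (suc n) ((false , suc ℓ) ∷ R)
  profile-free ℓ afterSquare afterPost = record
    { stuck⇒vanishes = λ { (there stuck) s → trans (tilings-free (pending R) n s)
        (⊕-vanishes (shift-vanishes (vanishes-∷ʳ R _ afterSquare (inj₁ stuck))) (vanishes-∷ʳ R _ afterPost (inj₁ stuck)) s) }
    ; lowestTerm = LowestTerm-resp (tilings-free (pending R) n) (free-lowestTerm ℓ afterSquare afterPost) }

Balanced : List ℕ → Set
Balanced ls = ∃[ a ] ∃[ b ] ∃[ ℓ ] ls ≡ replicate a (suc ℓ) ++ replicate b ℓ

sum-replicate : ∀ a x → sum (replicate a x) ≡ a * x
sum-replicate zero x = refl
sum-replicate (suc a) x = cong (x +_) (sum-replicate a x)

product-replicate : ∀ a x → product (replicate a x) ≡ x ^ a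
product-replicate zero x = refl
product-replicate (suc a) x = cong (x *_) (product-replicate a x)

replicate-∷ʳ : ∀ {A : Set} b (x : A) → replicate b x ++ [ x ] ≡ replicate (suc b) x
replicate-∷ʳ zero x = refl
replicate-∷ʳ (suc b) x = cong (x ∷_) (replicate-∷ʳ b x)

balanced-head : ∀ {ℓ ls n} → Balanced (ℓ ∷ ls) → sum (ℓ ∷ ls) ≡ suc n → ∃[ ℓ' ] ℓ ≡ suc ℓ'
balanced-head (suc a , b , c , eq) _ = c , ∷-injectiveˡ eq
balanced-head (zero , suc b , suc c , eq) _ = c , ∷-injectiveˡ eq
balanced-head {ℓ} {ls} {n} (zero , suc b , zero , eq) total = ⊥-elim (0≢1+n (begin
  0                           ≡⟨ *-zeroʳ (suc b) ⟨
  suc b * 0                   ≡⟨ sum-replicate (suc b) 0 ⟨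
  sum (replicate (suc b) 0)   ≡⟨ cong sum eq ⟨
  sum (ℓ ∷ ls)                ≡⟨ total ⟩
  suc n                       ∎))
  where open ≡-Reasoning

balanced-rotate : ∀ {ℓ ls} → Balanced (suc ℓ ∷ ls) → Balanced (ls ++ [ ℓ ])
balanced-rotate (suc a , b , c , eq) with suc-injective (∷-injectiveˡ eq)
... | refl = a , suc b , c , trans (cong (_++ [ c ]) (∷-injectiveʳ eq))
                                   (trans (++-assoc (replicate a (suc c)) _ _) (cong (replicate a (suc c) ++_) (replicate-∷ʳ b c)))
balanced-rotate (zero , suc b , suc c , eq) with suc-injective (∷-injectiveˡ eq)
... | refl = b , 1 , c , cong (_++ [ c ]) (∷-injectiveʳ eq)

sum-rotate : ∀ {ℓ ls n} → sum (suc ℓ ∷ ls) ≡ suc n → sum (ls ++ [ ℓ ]) ≡ n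
sum-rotate {ℓ} {ls} total =
  trans (sum-++ ls [ ℓ ]) (trans (cong (sum ls +_) (+-identityʳ ℓ)) (trans (+-comm (sum ls) ℓ) (suc-injective total)))

lengths-∷ʳ : ∀ R (y : Thread) → lengths (R ++ [ y ]) ≡ lengths R ++ [ proj₂ y ]
lengths-∷ʳ R y = map-++ proj₂ R [ y ]

balanced⇒profile : ∀ n st → Balanced (lengths st) → sum (lengths st) ≡ n → Profile n st
balanced⇒profile zero st _ total = profile-exhausted st total
balanced⇒profile (suc n) ((b , ℓ) ∷ R) balanced total with balanced-head balanced total
... | ℓ' , refl = profile-step b
  where
  next : ∀ y → Profile n (R ++ [ (y , ℓ') ])
  next y = balanced⇒profile n _ (subst Balanced (sym (lengths-∷ʳ R (y , ℓ'))) (balanced-rotate balanced))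
                               (trans (cong sum (lengths-∷ʳ R (y , ℓ'))) (sum-rotate {ls = lengths R} total))
  profile-step : ∀ b → Profile (suc n) ((b , suc ℓ') ∷ R)
  profile-step true = profile-pending R ℓ' (next false)
  profile-step false = profile-free R ℓ' (next false) (next true)

fresh : List ℕ → State
fresh = map (false ,_)

pending-fresh : ∀ ls → pending (fresh ls) ≡ replicate (length ls) false
pending-fresh [] = refl
pending-fresh (ℓ ∷ ls) = cong (false ∷_) (pending-fresh ls)

fenceNum-threads : ∀ ls {m n k} → Balanced ls → length ls ≡ m → 1 ≤ m → k ≤ n →
  n + k ≡ sum ls → n ∸ k ≡ sum (map parity ls) → fenceNum m n k ≡ product (map minTilings ls)
fenceNum-threads ls {m} {n} {k} balanced length≡m 1≤m k≤n total squares≡ = begin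
  fenceNum m n k                                              ≡⟨ fenceNum≡tilings 1≤m k≤n ⟩
  tilings (replicate m false) (n + k) (n ∸ k)                 ≡⟨ cong₂ (λ q s → tilings q (n + k) s) pending≡ (trans squares≡ minSquares≡) ⟩
  tilings (pending (fresh ls)) (n + k) (minSquares (fresh ls)) ≡⟨ lowest (lowestTerm profile) ⟩
  minCount (fresh ls)                                         ≡⟨ cong product (map-∘ ls) ⟨
  product (map minTilings ls)                                 ∎
  where
  open ≡-Reasoning
  lengths≡ : lengths (fresh ls) ≡ ls
  lengths≡ = trans (sym (map-∘ ls)) (map-id ls)
  profile : Profile (n + k) (fresh ls)
  profile = balanced⇒profile (n + k) (fresh ls) (subst Balanced (sym lengths≡) balanced) (trans (cong sum lengths≡) (sym total))
  pending≡ : replicate m false ≡ pending (fresh ls)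
  pending≡ = trans (cong (λ l → replicate l false) (sym length≡m)) (sym (pending-fresh ls))
  minSquares≡ : sum (map parity ls) ≡ minSquares (fresh ls)
  minSquares≡ = cong sum (map-∘ ls)

module _ (a b x y : ℕ) where

  map-blocks : (f : ℕ → ℕ) → map f (replicate a x ++ replicate b y) ≡ replicate a (f x) ++ replicate b (f y)
  map-blocks f = trans (map-++ f (replicate a x) _) (cong₂ _++_ (map-replicate f a x) (map-replicate f b y))

  sum-blocks : sum (replicate a x ++ replicate b y) ≡ a * x + b * y
  sum-blocks = trans (sum-++ (replicate a x) _) (cong₂ _+_ (sum-replicate a x) (sum-replicate b y))

  product-blocks : product (replicate a x ++ replicate b y) ≡ x ^ a * y ^ b
  product-blocks = trans (product-++ (replicate a x) _) (cong₂ _*_ (product-replicate a x) (product-replicate b y))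

  length-blocks : length (replicate a x ++ replicate b y) ≡ a + b
  length-blocks = trans (length-++ (replicate a x)) (cong₂ _+_ (length-replicate a) (length-replicate b))

fenceNum-balanced : ∀ a b ℓ {m n k} → a + b ≡ m → 1 ≤ m → k ≤ n →
  n + k ≡ a * suc ℓ + b * ℓ → n ∸ k ≡ a * parity (suc ℓ) + b * parity ℓ →
  fenceNum m n k ≡ minTilings (suc ℓ) ^ a * minTilings ℓ ^ b
fenceNum-balanced a b ℓ {m} {n} {k} a+b≡m 1≤m k≤n total difference = begin
  fenceNum m n k                       ≡⟨ fenceNum-threads ls (a , b , ℓ , refl) (trans (length-blocks a b _ _) a+b≡m) 1≤m k≤n
                                            (trans total (sym (sum-blocks a b _ _)))
                                            (trans difference (sym (trans (cong sum (map-blocks a b _ _ parity)) (sum-blocks a b _ _)))) ⟩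
  product (map minTilings ls)          ≡⟨ cong product (map-blocks a b _ _ minTilings) ⟩
  product (replicate a (minTilings (suc ℓ)) ++ replicate b (minTilings ℓ)) ≡⟨ product-blocks a b _ _ ⟩
  minTilings (suc ℓ) ^ a * minTilings ℓ ^ b ∎
  where
  open ≡-Reasoning
  ls = replicate a (suc ℓ) ++ replicate b ℓ

parity-double : ∀ j → parity (j + j) ≡ 0
parity-double zero = refl
parity-double (suc j) rewrite +-suc j j = parity-double j

parity-double+1 : ∀ j → parity (suc (j + j)) ≡ 1
parity-double+1 zero = refl
parity-double+1 (suc j) rewrite +-suc j j = parity-double+1 j

minTilings-double : ∀ j → minTilings (j + j) ≡ 1
minTilings-double j = minTilings-even (j + j) (parity-double j)

minTilings-double+1 : ∀ j → minTilings (suc (j + j)) ≡ suc j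
minTilings-double+1 zero = refl
minTilings-double+1 (suc j) rewrite +-suc j j =
  trans (cong₂ _+_ (minTilings-double+1 j) (parity-double+1 j)) (+-comm (suc j) 1)

fenceNum-mj+p : ∀ {m p} j → 1 ≤ m → p ≤ m → fenceNum m (m * j + p) (m * j) ≡ suc j ^ p
fenceNum-mj+p {p = p} j 1≤m p≤m with m≤n⇒∃[o]m+o≡n p≤m
... | q , refl = begin
  fenceNum (p + q) ((p + q) * j + p) ((p + q) * j)
    ≡⟨ fenceNum-balanced p q (j + j) {n = (p + q) * j + p} refl 1≤m (m≤m+n _ p) (total p q j) difference ⟩
  minTilings (suc (j + j)) ^ p * minTilings (j + j) ^ q
    ≡⟨ cong₂ (λ x y → x ^ p * y ^ q) (minTilings-double+1 j) (minTilings-double j) ⟩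
  suc j ^ p * 1 ^ q
    ≡⟨ trans (cong (suc j ^ p *_) (^-zeroˡ q)) (*-identityʳ _) ⟩
  suc j ^ p ∎
  where
  open ≡-Reasoning
  total : ∀ p q j → (p + q) * j + p + (p + q) * j ≡ p * suc (j + j) + q * (j + j)
  total = solve-∀
  difference : (p + q) * j + p ∸ (p + q) * j ≡ p * parity (suc (j + j)) + q * parity (j + j)
  difference = begin
    (p + q) * j + p ∸ (p + q) * j ≡⟨ m+n∸m≡n ((p + q) * j) p ⟩
    p                              ≡⟨ solve-∀′ p q ⟩
    p * 1 + q * 0                  ≡⟨ cong₂ (λ x y → p * x + q * y) (parity-double+1 j) (parity-double j) ⟨
    p * parity (suc (j + j)) + q * parity (j + j) ∎
    where
    solve-∀′ : ∀ p q → p ≡ p * 1 + q * 0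
    solve-∀′ = solve-∀

fenceNum-mj∸p : ∀ {m p} j → 1 ≤ m → p ≤ m → fenceNum m (m * suc j) (m * suc j ∸ p) ≡ suc j ^ p
fenceNum-mj∸p {p = p} j 1≤m p≤m with m≤n⇒∃[o]m+o≡n p≤m
... | q , refl = begin
  fenceNum (p + q) ((p + q) * suc j) ((p + q) * suc j ∸ p)
    ≡⟨ cong₂ (fenceNum (p + q)) (split p q j) (trans (cong (_∸ p) (split p q j)) (m+n∸m≡n p X)) ⟩
  fenceNum (p + q) (p + X) X
    ≡⟨ fenceNum-balanced q p (suc (j + j)) (+-comm q p) 1≤m (m≤n+m X p) (total p q j) difference ⟩
  minTilings (suc (suc (j + j))) ^ q * minTilings (suc (j + j)) ^ p
    ≡⟨ cong₂ (λ x y → x ^ q * y ^ p) (cong₂ _+_ (minTilings-double j) (parity-double j)) (minTilings-double+1 j) ⟩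
  1 ^ q * suc j ^ p
    ≡⟨ trans (cong (_* suc j ^ p) (^-zeroˡ q)) (*-identityˡ _) ⟩
  suc j ^ p ∎
  where
  open ≡-Reasoning
  X = q + (p + q) * j
  split : ∀ p q j → (p + q) * suc j ≡ p + (q + (p + q) * j)
  split = solve-∀
  total : ∀ p q j → p + (q + (p + q) * j) + (q + (p + q) * j) ≡ q * suc (suc (j + j)) + p * suc (j + j)
  total = solve-∀
  difference : p + X ∸ X ≡ q * parity (suc (suc (j + j))) + p * parity (suc (j + j))
  difference = begin
    p + X ∸ X       ≡⟨ m+n∸n≡m p X ⟩
    p               ≡⟨ solve-∀′ p q ⟩
    q * 0 + p * 1   ≡⟨ cong₂ (λ x y → q * x + p * y) (parity-double j) (parity-double+1 j) ⟨
    q * parity (suc (suc (j + j))) + p * parity (suc (j + j)) ∎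
    where
    solve-∀′ : ∀ p q → p ≡ q * 0 + p * 1
    solve-∀′ = solve-∀

mainTheorem18 : (j m p : ℕ) → 1 ≤ j → 1 ≤ m → p ≤ m →
    (fenceNum m (m * (j ∸ 1) + p) (m * (j ∸ 1)) ≡ j ^ p) × (fenceNum m (m * j) (m * j ∸ p) ≡ j ^ p)
mainTheorem18 (suc j) m p _ 1≤m p≤m = fenceNum-mj+p j 1≤m p≤m , fenceNum-mj∸p j 1≤m p≤m
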